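{- Let $G\in\mathcal{C}_{n,m}$. If $G$ is strong, then $G$ is Whitney-maximum.
   Context: $\mathcal{C}_{n,m}$ denotes the set of all connected simple graphs on $n$ vertices and $m$ edges. For a graph on $n$ vertices with $e$ edges and $\kappa$ connected components, its rank is $n-\kappa$ and its corank is $e-n+\kappa$; write $r(\cdot)$, $c(\cdot)$. $\mathcal{S}(G)$ is the set of spanning subgraphs of $G$. The Whitney polynomial is $W_G(x,y)=\sum_{H\in\mathcal{S}(G)}x^{r(G)-r(H)}y^{c(H)}$. A bivariate polynomial is nonnegative if it can be written as $\sum_{i,j}a_{ij}x^iy^j$ with finitely many real coefficients $a_{ij}\ge 0$. $N_i^{(k)}(G)$ is the number of spanning subgraphs of $G$ having exactly $i$ edges and at most $k$ connected components. $G\in\mathcal{C}_{n,m}$ is strong if $N_i^{(k)}(G)\ge N_i^{(k)}(H)$ for every $H\in\mathcal{C}_{n,m}$, every $i\in\{0,\ldots,m\}$ and every $k\in\{1,\ldots,n\}$. $G\in\mathcal{C}_{n,m}$ is Whitney-maximum if for every $H\in\mathcal{C}_{n,m}$ there is a nonnegative polynomial $Q_H$ with $W_G(x,y)-W_H(x,y)=(1-xy)Q_H(x,y)$. -}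

module Defs where

open import Data.Nat using (ℕ; zero; suc; _+_; _∸_; _≤_; _<_; _≤ᵇ_)
open import Data.Fin as Fin using (Fin; toℕ)
open import Data.Bool using (Bool; true; false; _∧_; _∨_; not; if_then_else_)
open import Data.List as L using (List; []; _∷_)
open import Data.Vec as V using (Vec; []; _∷_; lookup)
open import Data.Product using (Σ; _×_; _,_; proj₁; proj₂; ∃)
open import Relation.Nullary.Decidable using (⌊_⌋)
open import Data.Bool.ListAction using (any; all)
open import Relation.Binary.PropositionalEquality using (_≡_)

-- An edge of a simple graph on vertex set Fin n: an unordered pair {i,j},
-- stored canonically as (i , j) with i < j (so no loops).
Edge : ℕ → Set
Edge n = Σ (Fin n × Fin n) (λ p → toℕ (proj₁ p) < toℕ (proj₂ p))

record Graph (n m : ℕ) : Set where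
  field
    edges    : Vec (Edge n) m
    distinct : ∀ a b → proj₁ (lookup edges a) ≡ proj₁ (lookup edges b) → a ≡ b
open Graph public

-- A spanning subgraph of a graph with m (distinct) edges is given by the
-- subset of edges it keeps, i.e. a selection vector in Vec Bool m.
-- This is a bijection with the set S(G) of spanning subgraphs.
Selection : ℕ → Set
Selection m = Vec Bool m

allSelections : (m : ℕ) → List (Selection m)
allSelections zero = [] ∷ []
allSelections (suc m) =
  L.map (true ∷_) (allSelections m) L.++ L.map (false ∷_) (allSelections m)

selEdges : ∀ {n m} → Vec (Edge n) m → Selection m → List (Fin n × Fin n)
selEdges [] [] = []
selEdges (e ∷ es) (true ∷ s) = proj₁ e ∷ selEdges es s
selEdges (e ∷ es) (false ∷ s) = selEdges es s

numEdges : ∀ {m} → Selection m → ℕ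
numEdges [] = 0
numEdges (true ∷ s) = suc (numEdges s)
numEdges (false ∷ s) = numEdges s

-- reach es k u v : v is reachable from u by a walk of length ≤ k
-- using edges from es (edges are undirected).
reach : ∀ {n} → List (Fin n × Fin n) → ℕ → Fin n → Fin n → Bool
reach es zero u v = ⌊ u Fin.≟ v ⌋
reach es (suc k) u v =
  reach es k u v ∨
  any (λ ab → (reach es k u (proj₁ ab) ∧ ⌊ proj₂ ab Fin.≟ v ⌋)
              ∨ (reach es k u (proj₂ ab) ∧ ⌊ proj₁ ab Fin.≟ v ⌋)) es

-- number of connected components of the graph on Fin n with edge list es:
-- the number of vertices v that are the least vertex of their component
-- (walks of length ≤ n suffice for connectivity on n vertices).
components : ∀ {n} → List (Fin n × Fin n) → ℕ
components {n} es =
  L.length (L.filter (λ v → all (λ u → not ((suc (toℕ u) ≤ᵇ toℕ v) ∧ reach es n u v)) (L.allFin n) Data.Bool.≟ true) (L.allFin n))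
  where import Data.Bool

κ : ∀ {n m} → Graph n m → Selection m → ℕ
κ G s = components (selEdges (edges G) s)

rank : ∀ {n m} → Graph n m → Selection m → ℕ
rank {n} G s = n ∸ κ G s

corank : ∀ {n m} → Graph n m → Selection m → ℕ
corank {n} G s = (numEdges s + κ G s) ∸ n

full : ∀ m → Selection m
full m = V.replicate m true

Connected : ∀ {n m} → Graph n m → Set
Connected {m = m} G = κ G (full m) ≡ 1

countSel : ∀ m → (Selection m → Bool) → ℕ
countSel m p = L.length (L.filter (λ s → p s Data.Bool.≟ true) (allSelections m))
  where import Data.Bool

_==_ : ℕ → ℕ → Bool
a == b = ⌊ a Data.Nat.≟ b ⌋
  where import Data.Nat

N : ∀ {n m} → Graph n m → ℕ → ℕ → ℕ
N {m = m} G i k = countSel m (λ s → (numEdges s == i) ∧ (κ G s ≤ᵇ k))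

Strong : ∀ {n m} → Graph n m → Set
Strong {n} {m} G =
  (H : Graph n m) → Connected H →
  (i : ℕ) → i ≤ m → (k : ℕ) → 1 ≤ k → k ≤ n → N H i k ≤ N G i k

-- Coefficient of x^i y^j in the Whitney polynomial
-- W_G(x,y) = Σ_{H ∈ S(G)} x^{r(G)-r(H)} y^{c(H)}.
W : ∀ {n m} → Graph n m → ℕ → ℕ → ℕ
W {m = m} G i j =
  countSel m (λ s → ((rank G (full m) ∸ rank G s) == i) ∧ (corank G s == j))

-- A bivariate polynomial with nonnegative coefficients, given by its
-- coefficient function (x^i y^j ↦ coeff i j) together with a bound on its support.
record NonnegPoly : Set where
  field
    coeff   : ℕ → ℕ → ℕ
    bound   : ℕ
    support : ∀ i j → bound ≤ i + j → coeff i j ≡ 0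
open NonnegPoly public

-- coefficient of x^i y^j in (1 - xy) Q is  Q_{i,j} - Q_{i-1,j-1};
-- P₁ - P₂ = (1 - xy) Q  coefficientwise, rearranged to avoid subtraction:
--   P₁_{ij} + Q_{i-1,j-1} = P₂_{ij} + Q_{ij}   (Q_{-1,·} = Q_{·,-1} = 0)
shiftQ : NonnegPoly → ℕ → ℕ → ℕ
shiftQ Q (suc i) (suc j) = coeff Q i j
shiftQ Q _ _ = 0

WhitneyMaximum : ∀ {n m} → Graph n m → Set
WhitneyMaximum {n} {m} G =
  (H : Graph n m) → Connected H →
  Σ NonnegPoly λ Q → ∀ i j → W G i j + shiftQ Q i j ≡ W H i j + coeff Q i j

{-# OPTIONS --safe #-}
module Submission where

-- For connected X on n vertices, a spanning subgraph with e edges and κ components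
-- contributes the monomial x^(κ-1) y^(e+κ-n) to W_X.  Dividing by 1 - xy adds up the
-- coefficients of W_X along the diagonals, so the coefficient of x^i y^j in W_X / (1 - xy)
-- counts the spanning subgraphs with e + i + 1 = j + n and κ ≤ i + 1: it is
-- N^(i+1)_(j+n-i-1)(X).  Hence W_G - W_H = (1 - xy) Q, where Q_ij is the difference of
-- these counts for G and H, which is nonnegative when G is strong.  The only graph
-- theory needed is 1 ≤ κ ≤ n ≤ e + κ; the last bound holds because adding an edge merges
-- at most two components.

open import Defs
open import Data.Bool.Base using (Bool; true; false; T; not; _∧_; _∨_)
open import Data.Bool.ListAction using (all)
open import Data.Bool.Properties using (_≟_; T-≡; T-∧; T-∨)
open import Data.Empty using (⊥; ⊥-elim)
open import Data.Fin.Base using (Fin; zero; toℕ)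
open import Data.Fin.Properties as Fin using (all?; ¬∀⟶∃¬; toℕ-injective)
open import Data.List.Base using (List; []; _∷_; length; filter; allFin)
open import Data.List.Membership.Propositional using (_∈_; find; lose)
open import Data.List.Membership.Propositional.Properties using (∈-allFin)
open import Data.List.Properties
  using (length-filter; filter-all; filter-none; filter-some; length-tabulate)
open import Data.List.Relation.Unary.All as All using (All; universal)
open import Data.List.Relation.Unary.All.Properties using (all⁺; all⁻; tabulate⁺; tabulate⁻)
open import Data.List.Relation.Unary.AllPairs using (_∷_)
open import Data.List.Relation.Unary.Any using (here; there)
open import Data.List.Relation.Unary.Any.Properties using (any⁺; any⁻)
open import Data.List.Relation.Unary.Unique.Propositional using (Unique)
open import Data.List.Relation.Unary.Unique.Propositional.Properties using (allFin⁺)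
open import Data.Nat.Base using (ℕ; zero; suc; _+_; _∸_; _≤_; _<_; _≤ᵇ_; z≤n; s≤s; s≤s⁻¹)
open import Data.Nat.Properties
  using ( _≤?_; _<?_; suc-injective; +-suc; +-comm; +-assoc; +-identityʳ; +-cancelʳ-≡
        ; m+n≡0⇒n≡0; ≤-reflexive; ≤-trans; <-trans; <-irrefl; <-cmp; ≤-<-trans; <-≤-trans
        ; <⇒≤; <⇒≱; ≰⇒>; ≤ᵇ⇒≤; ≤⇒≤ᵇ; m≤m+n; m≤n+m; m<m+n; m≤n⇒m≤1+n; +-mono-≤; +-monoʳ-≤
        ; ∸-+-assoc; +-∸-assoc; m∸[m∸n]≡n; m∸n+n≡m; m+[n∸m]≡n; m+n∸n≡m; n∸n≡0; 0∸n≡0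
        ; module ≤-Reasoning )
open import Data.Product.Base using (_×_; _,_; proj₁; proj₂; ∃-syntax; map₁)
open import Data.Product.Properties using (,-injectiveˡ; ,-injectiveʳ)
open import Data.Sum.Base using (_⊎_; inj₁; inj₂; [_,_])
open import Data.Sum.Function.Propositional using (_⊎-⇔_)
open import Data.Vec.Base using (Vec; []; _∷_)
open import Function.Base using (id; _∘_)
open import Function.Bundles using (_⇔_; mk⇔; Equivalence)
import Function.Properties.Equivalence as ⇔
open import Relation.Binary.Construct.Closure.Equivalence using (EqClosure; symmetric)
open import Relation.Binary.Construct.Closure.ReflexiveTransitive using (ε; _◅_; _◅◅_)
open import Relation.Binary.Construct.Closure.Symmetric using (SymClosure; fwd; bwd)
open import Relation.Binary.Definitions using (Decidable; tri<; tri≈; tri>)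
open import Relation.Binary.PropositionalEquality
  using (_≡_; _≢_; refl; sym; trans; cong; cong₂; subst; subst₂; module ≡-Reasoning)
open import Relation.Nullary.Decidable
  using (yes; no; ⌊_⌋; map′; ¬?; T?; _→-dec_; toWitness; fromWitness; decidable-stable)
open import Relation.Nullary.Negation using (¬_)

-- Counting with Boolean predicates

-- Defs.countSel m p is count p (allSelections m) on the nose.
count : {A : Set} → (A → Bool) → List A → ℕ
count p xs = length (filter (λ x → p x ≟ true) xs)

T-not : ∀ {b} → T (not b) ⇔ (¬ T b)
T-not {true}  = mk⇔ (λ ()) (λ ¬b → ¬b _)
T-not {false} = mk⇔ (λ _ ()) _

length-allFin : ∀ n → length (allFin n) ≡ n
length-allFin n = length-tabulate id

module _ {A : Set} where

  count-⊎ : {p q r : A → Bool} → (∀ x → T (p x) ⇔ (T (q x) ⊎ T (r x))) →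
            (∀ x → T (q x) → ¬ T (r x)) → ∀ xs → count p xs ≡ count q xs + count r xs
  count-⊎ split disjoint [] = refl
  count-⊎ {p} {q} {r} split disjoint (x ∷ xs)
    with p x | q x | r x | split x | disjoint x | count-⊎ split disjoint xs
  ... | true  | true  | false | _  | _  | ih = cong suc ih
  ... | true  | false | true  | _  | _  | ih = trans (cong suc ih) (sym (+-suc _ _))
  ... | false | false | false | _  | _  | ih = ih
  ... | true  | true  | true  | _  | qr | _  = ⊥-elim (qr _ _)
  ... | true  | false | false | pq | _  | _  = ⊥-elim ([ id , id ] (Equivalence.to pq _))
  ... | false | true  | _     | pq | _  | _  = ⊥-elim (Equivalence.from pq (inj₁ _))
  ... | false | false | true  | pq | _  | _  = ⊥-elim (Equivalence.from pq (inj₂ _))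

  count-cong : {p q : A → Bool} → (∀ x → T (p x) ⇔ T (q x)) → ∀ xs → count p xs ≡ count q xs
  count-cong p⇔q [] = refl
  count-cong {p} {q} p⇔q (x ∷ xs) with p x | q x | p⇔q x
  ... | true  | true  | _ = cong suc (count-cong p⇔q xs)
  ... | false | false | _ = count-cong p⇔q xs
  ... | true  | false | e = ⊥-elim (Equivalence.to e _)
  ... | false | true  | e = ⊥-elim (Equivalence.from e _)

  count-split : ∀ (p q : A → Bool) xs →
                count p xs ≡ count (λ x → p x ∧ q x) xs + count (λ x → p x ∧ not (q x)) xs
  count-split p q = count-⊎ (λ x → by-cases (p x) (q x)) (λ x → disjoint (p x) (q x))
    where
    by-cases : ∀ a b → T a ⇔ (T (a ∧ b) ⊎ T (a ∧ not b))
    by-cases true  true  = mk⇔ inj₁ _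
    by-cases true  false = mk⇔ inj₂ _
    by-cases false _     = mk⇔ (λ ()) [ id , id ]
    disjoint : ∀ a b → T (a ∧ b) → ¬ T (a ∧ not b)
    disjoint true true _ ()

  count-⊆ : {p q : A → Bool} → (∀ x → T (p x) → T (q x)) →
            ∀ xs → count q xs ≡ count p xs + count (λ x → q x ∧ not (p x)) xs
  count-⊆ {p} {q} p⇒q xs =
    trans (count-split q p xs) (cong (_+ count (λ x → q x ∧ not (p x)) xs) (count-cong both⇔p xs))
    where
    both⇔p : ∀ x → T (q x ∧ p x) ⇔ T (p x)
    both⇔p x with q x | p x | p⇒q x
    ... | true  | true  | _   = mk⇔ _ _
    ... | true  | false | _   = mk⇔ id id
    ... | false | true  | p⇒q = mk⇔ (λ ()) p⇒q
    ... | false | false | _   = mk⇔ id id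

  count-mono : {p q : A → Bool} → (∀ x → T (p x) → T (q x)) → ∀ xs → count p xs ≤ count q xs
  count-mono p⇒q xs = subst (_ ≤_) (sym (count-⊆ p⇒q xs)) (m≤m+n _ _)

  count-pos : {p : A → Bool} {x : A} {xs : List A} → x ∈ xs → T (p x) → 0 < count p xs
  count-pos {p} x∈xs px = filter-some (λ x → p x ≟ true) (lose x∈xs (Equivalence.to T-≡ px))

  count-< : {p q : A → Bool} {x : A} {xs : List A} → (∀ x → T (p x) → T (q x)) →
            x ∈ xs → T (q x) → ¬ T (p x) → count p xs < count q xs
  count-< {xs = xs} p⇒q x∈xs qx ¬px = subst (_ <_) (sym (count-⊆ p⇒q xs))
    (m<m+n _ (count-pos x∈xs (Equivalence.from T-∧ (qx , Equivalence.from T-not ¬px))))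

  count≡0 : {p : A → Bool} {xs : List A} → All (λ x → ¬ T (p x)) xs → count p xs ≡ 0
  count≡0 {p} never =
    cong length (filter-none (λ x → p x ≟ true) (All.map (_∘ Equivalence.from T-≡) never))

  count≡length : {p : A → Bool} → (∀ x → T (p x)) → ∀ xs → count p xs ≡ length xs
  count≡length {p} always xs =
    cong length (filter-all (λ x → p x ≟ true) (universal (Equivalence.to T-≡ ∘ always) xs))

  count≤length : (p : A → Bool) → ∀ xs → count p xs ≤ length xs
  count≤length p = length-filter (λ x → p x ≟ true)

  count≤1 : {p : A → Bool} {xs : List A} → Unique xs →
            (∀ {x y} → T (p x) → T (p y) → x ≡ y) → count p xs ≤ 1
  count≤1 {xs = []} _ _ = z≤n
  count≤1 {p} {x ∷ xs} (x∉xs ∷ unique) single with p x in px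
  ... | false = count≤1 unique single
  ... | true  = s≤s (≤-reflexive (count≡0
    (All.map (λ x≢y py → x≢y (single (Equivalence.from T-≡ px) py)) x∉xs)))

-- Reachability and connectivity

Joined : ∀ {n} → List (Fin n × Fin n) → Fin n → Fin n → Set
Joined es u v = (u , v) ∈ es

Linked : ∀ {n} → List (Fin n × Fin n) → Fin n → Fin n → Set
Linked es = EqClosure (Joined es)

-- A record, so that k, u and v can be inferred from a proof.
record Reaches {n : ℕ} (es : List (Fin n × Fin n)) (k : ℕ) (u v : Fin n) : Set where
  constructor ⟨_⟩
  field reaches : T (reach es k u v)
open Reaches

module _ {n : ℕ} (es : List (Fin n × Fin n)) where

  reach-suc⇔ : ∀ {k u v} → Reaches es (suc k) u v ⇔
               (Reaches es k u v ⊎ ∃[ w ] Reaches es k u w × SymClosure (Joined es) w v)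
  reach-suc⇔ {k} {u} {v} = mk⇔ to from
    where
    crossing : Fin n × Fin n → Bool
    crossing (x , y) = (reach es k u x ∧ ⌊ y Fin.≟ v ⌋) ∨ (reach es k u y ∧ ⌊ x Fin.≟ v ⌋)

    across : ∀ {xy} → xy ∈ es → T (crossing xy) → Reaches es (suc k) u v
    across xy∈es crosses =
      ⟨ Equivalence.from (T-∨ {reach es k u v}) (inj₂ (any⁺ crossing (lose xy∈es crosses))) ⟩

    to : Reaches es (suc k) u v →
         Reaches es k u v ⊎ ∃[ w ] Reaches es k u w × SymClosure (Joined es) w v
    to ⟨ r ⟩ with Equivalence.to (T-∨ {reach es k u v}) r
    ... | inj₁ r′ = inj₁ ⟨ r′ ⟩
    ... | inj₂ via-edge with find (any⁻ crossing es via-edge)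
    ... | (x , y) , xy∈es , crosses
        with Equivalence.to (T-∨ {reach es k u x ∧ ⌊ y Fin.≟ v ⌋}) crosses
    ...   | inj₁ forward with Equivalence.to (T-∧ {reach es k u x}) forward
    ...     | ux , y≡v with toWitness {a? = y Fin.≟ v} y≡v
    ...       | refl = inj₂ (x , ⟨ ux ⟩ , fwd xy∈es)
    to ⟨ r ⟩ | inj₂ _ | (x , y) , xy∈es , _ | inj₂ backward
        with Equivalence.to (T-∧ {reach es k u y}) backward
    ...     | uy , x≡v with toWitness {a? = x Fin.≟ v} x≡v
    ...       | refl = inj₂ (y , ⟨ uy ⟩ , bwd xy∈es)

    from : Reaches es k u v ⊎ ∃[ w ] Reaches es k u w × SymClosure (Joined es) w v →
           Reaches es (suc k) u v
    from (inj₁ ⟨ r ⟩) = ⟨ Equivalence.from (T-∨ {reach es k u v}) (inj₁ r) ⟩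
    from (inj₂ (w , ⟨ r ⟩ , fwd wv∈es)) =
      across wv∈es (Equivalence.from T-∨ (inj₁ (Equivalence.from T-∧ (r , fromWitness refl))))
    from (inj₂ (w , ⟨ r ⟩ , bwd vw∈es)) =
      across vw∈es (Equivalence.from T-∨ (inj₂ (Equivalence.from T-∧ (r , fromWitness refl))))

  reach-suc : ∀ {k u v} → Reaches es k u v → Reaches es (suc k) u v
  reach-suc r = Equivalence.from reach-suc⇔ (inj₁ r)

  reach-step : ∀ {k u w v} → Reaches es k u w → SymClosure (Joined es) w v →
               Reaches es (suc k) u v
  reach-step r step = Equivalence.from reach-suc⇔ (inj₂ (_ , r , step))

  reach-refl : ∀ k u → Reaches es k u u
  reach-refl zero    u = ⟨ fromWitness refl ⟩
  reach-refl (suc k) u = reach-suc (reach-refl k u)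

  reach-sound : ∀ k {u v} → Reaches es k u v → Linked es u v
  reach-sound zero {u} {v} ⟨ r ⟩ with toWitness {a? = u Fin.≟ v} r
  ... | refl = ε
  reach-sound (suc k) r with Equivalence.to reach-suc⇔ r
  ... | inj₁ r′               = reach-sound k r′
  ... | inj₂ (w , r′ , step) = reach-sound k r′ ◅◅ (step ◅ ε)

  Stable : ℕ → Fin n → Set
  Stable k u = ∀ v → Reaches es (suc k) u v → Reaches es k u v

  stable-suc : ∀ {k u} → Stable k u → Stable (suc k) u
  stable-suc stable v r with Equivalence.to reach-suc⇔ r
  ... | inj₁ r′               = r′
  ... | inj₂ (w , r′ , step) = reach-step (stable w r′) step

  reached : ℕ → Fin n → ℕ
  reached k u = count (reach es k u) (allFin n)

  stable-or-grows : ∀ k u → Stable k u ⊎ reached k u < reached (suc k) u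
  stable-or-grows k u with all? (λ v → T? (reach es (suc k) u v) →-dec T? (reach es k u v))
  ... | yes stable = inj₁ (λ v r → ⟨ stable v (reaches r) ⟩)
  ... | no unstable
      with ¬∀⟶∃¬ n _ (λ v → T? (reach es (suc k) u v) →-dec T? (reach es k u v)) unstable
  ... | v , new = inj₂ (count-< (λ v r → reaches (reach-suc {k} {u} {v} ⟨ r ⟩)) (∈-allFin v)
    (decidable-stable (T? _) (λ ¬now → new (⊥-elim ∘ ¬now))) (λ before → new (λ _ → before)))

  -- Until it stabilises, reach es k u gains a vertex at every step; there are only n vertices.
  stable-or-spread : ∀ k u → Stable k u ⊎ k < reached k u
  stable-or-spread zero    u = inj₂ (count-pos (∈-allFin u) (reaches (reach-refl 0 u)))
  stable-or-spread (suc k) u with stable-or-spread k u | stable-or-grows k u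
  ... | _           | inj₁ stable = inj₁ (stable-suc stable)
  ... | inj₁ stable | inj₂ _      = inj₁ (stable-suc stable)
  ... | inj₂ spread | inj₂ grows  = inj₂ (≤-<-trans spread grows)

  reach-stable : ∀ u → Stable n u
  reach-stable u with stable-or-spread n u
  ... | inj₁ stable = stable
  ... | inj₂ spread = ⊥-elim (<⇒≱ spread
    (subst (reached n u ≤_) (length-allFin n) (count≤length _ (allFin n))))

  reach-complete : ∀ {u v} → Linked es u v → Reaches es n u v
  reach-complete {u} = extend (reach-refl n u)
    where
    extend : ∀ {w v} → Reaches es n u w → Linked es w v → Reaches es n u v
    extend r ε              = r
    extend r (step ◅ steps) = extend (reach-stable u _ (reach-step r step)) steps

  linked? : Decidable (Linked es)
  linked? u v = map′ (reach-sound n ∘ ⟨_⟩) (reaches ∘ reach-complete) (T? (reach es n u v))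

-- Components

module _ {n : ℕ} (es : List (Fin n × Fin n)) where

  -- components es unfolds to count (isRoot es) (allFin n).
  isRoot : Fin n → Bool
  isRoot v = all (λ u → not ((suc (toℕ u) ≤ᵇ toℕ v) ∧ reach es n u v)) (allFin n)

  isRoot⇔ : ∀ {v} → T (isRoot v) ⇔ (∀ u → toℕ u < toℕ v → ¬ Linked es u v)
  isRoot⇔ {v} = mk⇔ to from
    where
    to : T (isRoot v) → ∀ u → toℕ u < toℕ v → ¬ Linked es u v
    to root u u<v link = Equivalence.to T-not (tabulate⁻ (all⁺ _ (allFin n) root) u)
      (Equivalence.from T-∧ (≤⇒≤ᵇ u<v , reaches (reach-complete es link)))
    from : (∀ u → toℕ u < toℕ v → ¬ Linked es u v) → T (isRoot v)
    from unlinked = all⁻ _ (tabulate⁺ λ u → Equivalence.from T-not λ earlier →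
      let u<v , r = Equivalence.to (T-∧ {suc (toℕ u) ≤ᵇ toℕ v}) earlier
      in unlinked u (≤ᵇ⇒≤ _ _ u<v) (reach-sound es n ⟨ r ⟩))

  ¬isRoot⇒ : ∀ {v} → ¬ T (isRoot v) → ∃[ u ] toℕ u < toℕ v × Linked es u v
  ¬isRoot⇒ {v} ¬root
    with ¬∀⟶∃¬ n _ (λ u → (toℕ u <? toℕ v) →-dec ¬? (linked? es u v))
                   (¬root ∘ Equivalence.from isRoot⇔)
  ... | u , ¬unlinked with toℕ u <? toℕ v | linked? es u v
  ...   | yes u<v | yes link = u , u<v , link
  ...   | yes _   | no ¬link = ⊥-elim (¬unlinked λ _ → ¬link)
  ...   | no ¬u<v | _        = ⊥-elim (¬unlinked λ u<v → ⊥-elim (¬u<v u<v))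

  components≤ : components es ≤ n
  components≤ = subst (components es ≤_) (length-allFin n) (count≤length isRoot (allFin n))

linked-[] : ∀ {n} {u v : Fin n} → Linked [] u v → u ≡ v
linked-[] ε            = refl
linked-[] (fwd () ◅ _)
linked-[] (bwd () ◅ _)

components-[] : ∀ {n} → components {n} [] ≡ n
components-[] {n} = trans (count≡length (λ v → Equivalence.from (isRoot⇔ {n} [] {v}) λ u u<v link →
  <-irrefl (cong toℕ (linked-[] link)) u<v) (allFin n)) (length-allFin n)

1≤components : ∀ {n} (es : List (Fin (suc n) × Fin (suc n))) → 1 ≤ components es
1≤components es = count-pos {p = isRoot es} (∈-allFin zero) (Equivalence.from (isRoot⇔ es {zero}) λ _ ())

module _ {n : ℕ} (a b : Fin n) (es : List (Fin n × Fin n)) where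

  Near : Fin n → Set
  Near x = Linked es x a ⊎ Linked es x b

  near-resp : ∀ {x y} → Linked es x y → Near y → Near x
  near-resp x~y (inj₁ y~a) = inj₁ (x~y ◅◅ y~a)
  near-resp x~y (inj₂ y~b) = inj₂ (x~y ◅◅ y~b)

  near-pigeonhole : ∀ {x y z} → Near x → Near y → Near z →
                    Linked es x y ⊎ Linked es x z ⊎ Linked es y z
  near-pigeonhole (inj₁ x~a) (inj₁ y~a) _          = inj₁ (x~a ◅◅ symmetric _ y~a)
  near-pigeonhole (inj₂ x~b) (inj₂ y~b) _          = inj₁ (x~b ◅◅ symmetric _ y~b)
  near-pigeonhole (inj₁ x~a) (inj₂ _)   (inj₁ z~a) = inj₂ (inj₁ (x~a ◅◅ symmetric _ z~a))
  near-pigeonhole (inj₂ x~b) (inj₁ _)   (inj₂ z~b) = inj₂ (inj₁ (x~b ◅◅ symmetric _ z~b))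
  near-pigeonhole (inj₁ _)   (inj₂ y~b) (inj₂ z~b) = inj₂ (inj₂ (y~b ◅◅ symmetric _ z~b))
  near-pigeonhole (inj₂ _)   (inj₁ y~a) (inj₁ z~a) = inj₂ (inj₂ (y~a ◅◅ symmetric _ z~a))

  linked-∷ : ∀ {x y} → Linked ((a , b) ∷ es) x y → Linked es x y ⊎ (Near x × Near y)
  linked-∷ ε              = inj₁ ε
  linked-∷ (step ◅ steps) = extend step (linked-∷ steps)
    where
    via-old : ∀ {x z y} → Linked es x z → Linked es z y ⊎ (Near z × Near y) →
              Linked es x y ⊎ (Near x × Near y)
    via-old x~z (inj₁ z~y)       = inj₁ (x~z ◅◅ z~y)
    via-old x~z (inj₂ (nz , ny)) = inj₂ (near-resp x~z nz , ny)
    far-end : ∀ {z y} → Near z → Linked es z y ⊎ (Near z × Near y) → Near y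
    far-end nz (inj₁ z~y)      = near-resp (symmetric _ z~y) nz
    far-end _  (inj₂ (_ , ny)) = ny
    extend : ∀ {x z y} → SymClosure (Joined ((a , b) ∷ es)) x z →
             Linked es z y ⊎ (Near z × Near y) → Linked es x y ⊎ (Near x × Near y)
    extend (fwd (here refl)) rest = inj₂ (inj₁ ε , far-end (inj₂ ε) rest)
    extend (bwd (here refl)) rest = inj₂ (inj₂ ε , far-end (inj₁ ε) rest)
    extend (fwd (there xz))  rest = via-old (fwd xz ◅ ε) rest
    extend (bwd (there zx))  rest = via-old (bwd zx ◅ ε) rest

  lostRoot : Fin n → Bool
  lostRoot v = isRoot es v ∧ not (isRoot ((a , b) ∷ es) v)

  lostRoot-root : ∀ {v} → T (lostRoot v) → ∀ u → toℕ u < toℕ v → ¬ Linked es u v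
  lostRoot-root {v} = Equivalence.to (isRoot⇔ es) ∘ proj₁ ∘ Equivalence.to (T-∧ {isRoot es v})

  lostRoot-witness : ∀ {v} → T (lostRoot v) → ∃[ u ] toℕ u < toℕ v × Near u × Near v
  lostRoot-witness {v} lost-v
    with ¬isRoot⇒ ((a , b) ∷ es)
           (Equivalence.to T-not (proj₂ (Equivalence.to (T-∧ {isRoot es v}) lost-v)))
  ... | u , u<v , link′ with linked-∷ link′
  ...   | inj₁ link       = ⊥-elim (lostRoot-root lost-v u u<v link)
  ...   | inj₂ (nu , nv) = u , u<v , nu , nv

  -- u, v and w would be pairwise unlinked in es, yet all near a or b.
  lostRoot-ordered : ∀ {v w} → toℕ v < toℕ w → T (lostRoot v) → T (lostRoot w) → ⊥
  lostRoot-ordered {v} {w} v<w lost-v lost-w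
    with lostRoot-witness lost-v | lostRoot-witness lost-w
  ... | u , u<v , nu , nv | _ , _ , _ , nw with near-pigeonhole nu nv nw
  ...   | inj₁ u~v        = lostRoot-root lost-v u u<v u~v
  ...   | inj₂ (inj₁ u~w) = lostRoot-root lost-w u (<-trans u<v v<w) u~w
  ...   | inj₂ (inj₂ v~w) = lostRoot-root lost-w v v<w v~w

  lostRoot-unique : ∀ {v w} → T (lostRoot v) → T (lostRoot w) → v ≡ w
  lostRoot-unique {v} {w} lost-v lost-w with <-cmp (toℕ v) (toℕ w)
  ... | tri< v<w _ _ = ⊥-elim (lostRoot-ordered v<w lost-v lost-w)
  ... | tri≈ _ v≡w _ = toℕ-injective v≡w
  ... | tri> _ _ w<v = ⊥-elim (lostRoot-ordered w<v lost-w lost-v)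

  components-∷ : components es ≤ suc (components ((a , b) ∷ es))
  components-∷ = begin
    components es
      ≡⟨ count-split (isRoot es) (isRoot ((a , b) ∷ es)) (allFin n) ⟩
    count (λ v → isRoot es v ∧ isRoot ((a , b) ∷ es) v) (allFin n) + count lostRoot (allFin n)
      ≤⟨ +-mono-≤ (count-mono (λ v → proj₂ ∘ Equivalence.to (T-∧ {isRoot es v})) (allFin n))
                  (count≤1 (allFin⁺ n) lostRoot-unique) ⟩
    components ((a , b) ∷ es) + 1
      ≡⟨ +-comm _ 1 ⟩
    suc (components ((a , b) ∷ es)) ∎
    where open ≤-Reasoning

n≤edges+components : ∀ {n} (es : List (Fin n × Fin n)) → n ≤ length es + components es
n≤edges+components []             = ≤-reflexive (sym components-[])
n≤edges+components ((a , b) ∷ es) = begin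
  _                                           ≤⟨ n≤edges+components es ⟩
  length es + components es                   ≤⟨ +-monoʳ-≤ (length es) (components-∷ a b es) ⟩
  length es + suc (components ((a , b) ∷ es)) ≡⟨ +-suc _ _ ⟩
  suc (length es) + components ((a , b) ∷ es) ∎
  where open ≤-Reasoning

-- The Whitney polynomial of a connected graph

T-==∧== : ∀ {a b i j} → T ((a == i) ∧ (b == j)) ⇔ ((a , b) ≡ (i , j))
T-==∧== {a} {b} {i} {j} = mk⇔
  (λ t → let a≡i , b≡j = Equivalence.to (T-∧ {a == i}) t
         in cong₂ _,_ (toWitness a≡i) (toWitness b≡j))
  (λ ab≡ij → Equivalence.from (T-∧ {a == i})
    (fromWitness (,-injectiveˡ ab≡ij) , fromWitness (,-injectiveʳ ab≡ij)))

T-==∧≤ᵇ : ∀ {a b c d} → T ((a == b) ∧ (c ≤ᵇ d)) ⇔ (a ≡ b × c ≤ d)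
T-==∧≤ᵇ {a} {b} {c} {d} = mk⇔
  (λ t → let a≡b , c≤d = Equivalence.to (T-∧ {a == b}) t in toWitness a≡b , ≤ᵇ⇒≤ c d c≤d)
  (λ (a≡b , c≤d) → Equivalence.from (T-∧ {a == b}) (fromWitness a≡b , ≤⇒≤ᵇ c≤d))

-- (k , c) ⊑ (i , j) iff x^i y^j = (xy)^d x^k y^c for some d.
_⊑_ : ℕ × ℕ → ℕ × ℕ → Set
(k , c) ⊑ (i , j) = ∃[ d ] k + d ≡ i × c + d ≡ j

⊑-refl : ∀ {p} → p ⊑ p
⊑-refl {k , c} = 0 , +-identityʳ k , +-identityʳ c

zero-offset : ∀ {k c i j} → k + 0 ≡ i → c + 0 ≡ j → (k , c) ≡ (i , j)
zero-offset {k} {c} k+0≡i c+0≡j =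
  cong₂ _,_ (trans (sym (+-identityʳ k)) k+0≡i) (trans (sym (+-identityʳ c)) c+0≡j)

⊑-zeroˡ : ∀ {k c j} → (k , c) ⊑ (0 , j) ⇔ (k , c) ≡ (0 , j)
⊑-zeroˡ {k} {c} = mk⇔ to λ { refl → ⊑-refl }
  where
  to : ∀ {j} → (k , c) ⊑ (0 , j) → (k , c) ≡ (0 , j)
  to (d , k+d≡0 , c+d≡j) with m+n≡0⇒n≡0 k k+d≡0
  ... | refl = zero-offset k+d≡0 c+d≡j

⊑-zeroʳ : ∀ {k c i} → (k , c) ⊑ (i , 0) ⇔ (k , c) ≡ (i , 0)
⊑-zeroʳ {k} {c} = mk⇔ to λ { refl → ⊑-refl }
  where
  to : ∀ {i} → (k , c) ⊑ (i , 0) → (k , c) ≡ (i , 0)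
  to (d , k+d≡i , c+d≡0) with m+n≡0⇒n≡0 c c+d≡0
  ... | refl = zero-offset k+d≡i c+d≡0

⊑-suc : ∀ {k c i j} →
        (k , c) ⊑ (suc i , suc j) ⇔ ((k , c) ≡ (suc i , suc j) ⊎ (k , c) ⊑ (i , j))
⊑-suc {k} {c} = mk⇔ to from
  where
  to : ∀ {i j} → (k , c) ⊑ (suc i , suc j) → (k , c) ≡ (suc i , suc j) ⊎ (k , c) ⊑ (i , j)
  to (zero  , k+0≡ , c+0≡)     = inj₁ (zero-offset k+0≡ c+0≡)
  to (suc d , k+d+1≡ , c+d+1≡) = inj₂ (d , suc-injective (trans (sym (+-suc k d)) k+d+1≡)
                                         , suc-injective (trans (sym (+-suc c d)) c+d+1≡))
  from : ∀ {i j} → (k , c) ≡ (suc i , suc j) ⊎ (k , c) ⊑ (i , j) → (k , c) ⊑ (suc i , suc j)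
  from (inj₁ refl)                = ⊑-refl
  from (inj₂ (d , k+d≡i , c+d≡j)) =
    suc d , trans (+-suc k d) (cong suc k+d≡i) , trans (+-suc c d) (cong suc c+d≡j)

⊑⇒≢suc : ∀ {k c i j} → (k , c) ⊑ (i , j) → (k , c) ≢ (suc i , suc j)
⊑⇒≢suc {k} (d , k+d≡i , _) kc≡ =
  <-irrefl (sym k+d≡i) (subst (_≤ k + d) (,-injectiveˡ kc≡) (m≤m+n k d))

[n∸1]∸[n∸κ]≡κ∸1 : ∀ {n κ} → κ ≤ n → (n ∸ 1) ∸ (n ∸ κ) ≡ κ ∸ 1
[n∸1]∸[n∸κ]≡κ∸1 {n} {κ} κ≤n = begin
  (n ∸ 1) ∸ (n ∸ κ)  ≡⟨ ∸-+-assoc n 1 (n ∸ κ) ⟩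
  n ∸ (1 + (n ∸ κ))  ≡⟨ cong (n ∸_) (+-comm 1 (n ∸ κ)) ⟩
  n ∸ ((n ∸ κ) + 1)  ≡⟨ sym (∸-+-assoc n (n ∸ κ) 1) ⟩
  (n ∸ (n ∸ κ)) ∸ 1  ≡⟨ cong (_∸ 1) (m∸[m∸n]≡n κ≤n) ⟩
  κ ∸ 1              ∎
  where open ≡-Reasoning

diagonal⇔ : ∀ {n e κ i j} → 1 ≤ κ → n ≤ e + κ →
            (e + suc i ≡ j + n × κ ≤ suc i) ⇔ (κ ∸ 1 , (e + κ) ∸ n) ⊑ (i , j)
diagonal⇔ {n} {e} {suc k} {i} {j} _ n≤e+κ = mk⇔ to from
  where
  c = (e + suc k) ∸ n
  shifted : ∀ d → (c + d) + n ≡ e + suc (k + d)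
  shifted d = begin
    (c + d) + n     ≡⟨ +-assoc c d n ⟩
    c + (d + n)     ≡⟨ cong (c +_) (+-comm d n) ⟩
    c + (n + d)     ≡⟨ sym (+-assoc c n d) ⟩
    (c + n) + d     ≡⟨ cong (_+ d) (m∸n+n≡m n≤e+κ) ⟩
    (e + suc k) + d ≡⟨ +-assoc e (suc k) d ⟩
    e + suc (k + d) ∎
    where open ≡-Reasoning
  to : e + suc i ≡ j + n × suc k ≤ suc i → (k , c) ⊑ (i , j)
  to (e+i+1≡j+n , k<i+1) = i ∸ k , k+[i∸k]≡i , +-cancelʳ-≡ n (c + (i ∸ k)) j
    (trans (shifted (i ∸ k)) (trans (cong (λ t → e + suc t) k+[i∸k]≡i) e+i+1≡j+n))
    where k+[i∸k]≡i = m+[n∸m]≡n (s≤s⁻¹ k<i+1)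
  from : (k , c) ⊑ (i , j) → e + suc i ≡ j + n × suc k ≤ suc i
  from (d , refl , refl) = sym (shifted d) , s≤s (m≤m+n k d)

numEdges≡length : ∀ {n m} (es : Vec (Edge n) m) (s : Selection m) →
                  numEdges s ≡ length (selEdges es s)
numEdges≡length []       []          = refl
numEdges≡length (_ ∷ es) (true ∷ s)  = cong suc (numEdges≡length es s)
numEdges≡length (_ ∷ es) (false ∷ s) = numEdges≡length es s

numEdges≤ : ∀ {m} (s : Selection m) → numEdges s ≤ m
numEdges≤ []          = z≤n
numEdges≤ (true ∷ s)  = s≤s (numEdges≤ s)
numEdges≤ (false ∷ s) = m≤n⇒m≤1+n (numEdges≤ s)

module _ {n m : ℕ} (X : Graph n m) where

  κ≤n : ∀ s → κ X s ≤ n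
  κ≤n s = components≤ (selEdges (edges X) s)

  n≤numEdges+κ : ∀ s → n ≤ numEdges s + κ X s
  n≤numEdges+κ s =
    subst (λ e → n ≤ e + κ X s) (sym (numEdges≡length (edges X) s)) (n≤edges+components _)

1≤κ : ∀ {n m} (X : Graph n m) → Connected X → ∀ s → 1 ≤ κ X s
1≤κ {zero}  _ ()
1≤κ {suc n} X _ s = 1≤components (selEdges (edges X) s)

shiftXY : (ℕ → ℕ → ℕ) → ℕ → ℕ → ℕ
shiftXY f (suc i) (suc j) = f i j
shiftXY f _       _       = 0

whitneyTerm : ∀ {n m} → Graph n m → ℕ → ℕ → Selection m → Bool
whitneyTerm {m = m} X i j s = ((rank X (full m) ∸ rank X s) == i) ∧ (corank X s == j)

-- N X (j + n ∸ suc i) (suc i), but written without ∸ so that it vanishes when j + n ≤ i.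
diagonalTerm : ∀ {n m} → Graph n m → ℕ → ℕ → Selection m → Bool
diagonalTerm {n} X i j s = ((numEdges s + suc i) == (j + n)) ∧ (κ X s ≤ᵇ suc i)

diagonalCount : ∀ {n m} → Graph n m → ℕ → ℕ → ℕ
diagonalCount {m = m} X i j = countSel m (diagonalTerm X i j)

module _ {n m : ℕ} (X : Graph n m) (X-connected : Connected X) where

  exponent : Selection m → ℕ × ℕ
  exponent s = κ X s ∸ 1 , corank X s

  whitney-exponent : ∀ {i j} s → T (whitneyTerm X i j s) ⇔ exponent s ≡ (i , j)
  whitney-exponent {i} {j} s =
    subst (λ r → T ((r == i) ∧ (corank X s == j)) ⇔ exponent s ≡ (i , j)) (sym rank-drop) T-==∧==
    where
    rank-drop : rank X (full m) ∸ rank X s ≡ κ X s ∸ 1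
    rank-drop = trans (cong (λ κ-full → (n ∸ κ-full) ∸ (n ∸ κ X s)) X-connected)
                      ([n∸1]∸[n∸κ]≡κ∸1 (κ≤n X s))

  diagonal-exponent : ∀ {i j} s → T (diagonalTerm X i j s) ⇔ exponent s ⊑ (i , j)
  diagonal-exponent {i} {j} s = ⇔.trans (T-==∧≤ᵇ {numEdges s + suc i} {j + n} {κ X s})
    (diagonal⇔ (1≤κ X X-connected s) (n≤numEdges+κ X s))

  diagonalCount≡W : ∀ {i j} → (∀ {k c} → (k , c) ⊑ (i , j) ⇔ (k , c) ≡ (i , j)) →
                    diagonalCount X i j ≡ W X i j
  diagonalCount≡W {i} {j} ⊑⇔≡ = count-cong {p = diagonalTerm X i j} {q = whitneyTerm X i j}
    (λ s → ⇔.trans (diagonal-exponent s) (⇔.trans ⊑⇔≡ (⇔.sym (whitney-exponent s))))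
    (allSelections m)

  diagonalCount-recurrence : ∀ i j → diagonalCount X i j ≡ W X i j + shiftXY (diagonalCount X) i j
  diagonalCount-recurrence zero    j       = trans (diagonalCount≡W ⊑-zeroˡ) (sym (+-identityʳ _))
  diagonalCount-recurrence (suc i) zero    = trans (diagonalCount≡W ⊑-zeroʳ) (sym (+-identityʳ _))
  diagonalCount-recurrence (suc i) (suc j) =
    count-⊎ {p = diagonalTerm X (suc i) (suc j)} {whitneyTerm X (suc i) (suc j)} {diagonalTerm X i j}
      (λ s → ⇔.trans (diagonal-exponent s)
               (⇔.trans ⊑-suc (⇔.sym (whitney-exponent s) ⊎-⇔ ⇔.sym (diagonal-exponent s))))
      (λ s w d → ⊑⇒≢suc (Equivalence.to (diagonal-exponent s) d) (Equivalence.to (whitney-exponent s) w))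
      (allSelections m)

module _ {n m : ℕ} (X : Graph n m) where

  diagonalCount≡N : ∀ {i j} → suc i ≤ j + n → diagonalCount X i j ≡ N X (j + n ∸ suc i) (suc i)
  diagonalCount≡N {i} {j} i<j+n = count-cong {p = diagonalTerm X i j} (λ s →
    ⇔.trans (T-==∧≤ᵇ {numEdges s + suc i} {j + n} {κ X s})
      (⇔.trans (mk⇔ (map₁ edges-to) (map₁ edges-from))
               (⇔.sym (T-==∧≤ᵇ {numEdges s} {j + n ∸ suc i} {κ X s}))))
    (allSelections m)
    where
    edges-to : ∀ {e} → e + suc i ≡ j + n → e ≡ j + n ∸ suc i
    edges-to {e} eq = trans (sym (m+n∸n≡m e (suc i))) (cong (_∸ suc i) eq)
    edges-from : ∀ {e} → e ≡ j + n ∸ suc i → e + suc i ≡ j + n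
    edges-from refl = m∸n+n≡m i<j+n

  N-vanishes : ∀ {e k} → m < e → N X e k ≡ 0
  N-vanishes {e} {k} m<e = count≡0 (universal (λ s t → <⇒≱ m<e
    (subst (_≤ m) (proj₁ (Equivalence.to (T-==∧≤ᵇ {numEdges s} {e} {κ X s} {k}) t)) (numEdges≤ s)))
    (allSelections m))

  diagonalCount-n≤i : ∀ {i j} → n ≤ i →
                      diagonalCount X i j ≡ countSel m (λ s → (numEdges s + suc i) == (j + n))
  diagonalCount-n≤i {i} {j} n≤i = count-cong {p = diagonalTerm X i j} (λ s →
    mk⇔ (proj₁ ∘ Equivalence.to (T-∧ {(numEdges s + suc i) == (j + n)}))
        (λ t → Equivalence.from T-∧ (t , ≤⇒≤ᵇ (≤-trans (κ≤n X s) (m≤n⇒m≤1+n n≤i)))))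
    (allSelections m)

  diagonalCount-vanishes : ∀ {i j} → i < n → m < j → diagonalCount X i j ≡ 0
  diagonalCount-vanishes {i} {j} i<n m<j = trans (diagonalCount≡N (≤-trans i<n (m≤n+m n j)))
    (N-vanishes (<-≤-trans m<j (subst (j ≤_) (sym (+-∸-assoc j i<n)) (m≤m+n j (n ∸ suc i)))))

diagonalCount-mono : ∀ {n m} (G : Graph n m) → Strong G →
                     ∀ H → Connected H → ∀ i j → diagonalCount H i j ≤ diagonalCount G i j
diagonalCount-mono {n} {m} G G-strong H H-connected i j with n ≤? i
... | yes n≤i = ≤-reflexive (trans (diagonalCount-n≤i H n≤i) (sym (diagonalCount-n≤i G n≤i)))
... | no  n≰i with j + n ∸ suc i ≤? m | ≤-trans (≰⇒> n≰i) (m≤n+m n j)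
...   | yes e≤m | i<j+n = subst₂ _≤_ (sym (diagonalCount≡N H i<j+n)) (sym (diagonalCount≡N G i<j+n))
                                   (G-strong H H-connected _ e≤m (suc i) (s≤s z≤n) (≰⇒> n≰i))
...   | no  e≰m | i<j+n =
  subst (_≤ _) (sym (trans (diagonalCount≡N H i<j+n) (N-vanishes H (≰⇒> e≰m)))) z≤n

diagonalCount-support : ∀ {n m} (G H : Graph n m) {i j} → n + m < i + j →
                        diagonalCount G i j ∸ diagonalCount H i j ≡ 0
diagonalCount-support {n} {m} G H {i} {j} n+m<i+j with n ≤? i
... | yes n≤i = trans (cong (_∸ diagonalCount H i j)
                            (trans (diagonalCount-n≤i G n≤i) (sym (diagonalCount-n≤i H n≤i))))
                      (n∸n≡0 (diagonalCount H i j))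
... | no  n≰i = trans (cong (_∸ diagonalCount H i j) (diagonalCount-vanishes G i<n m<j))
                      (0∸n≡0 (diagonalCount H i j))
  where
  i<n = ≰⇒> n≰i
  m<j = ≰⇒> (λ j≤m → <⇒≱ n+m<i+j (+-mono-≤ (<⇒≤ i<n) j≤m))

shiftQ≡shiftXY : ∀ Q i j → shiftQ Q i j ≡ shiftXY (coeff Q) i j
shiftQ≡shiftXY Q zero    j       = refl
shiftQ≡shiftXY Q (suc i) zero    = refl
shiftQ≡shiftXY Q (suc i) (suc j) = refl

shiftXY-mono : ∀ {f g} → (∀ i j → f i j ≤ g i j) → ∀ i j → shiftXY f i j ≤ shiftXY g i j
shiftXY-mono f≤g zero    j       = z≤n
shiftXY-mono f≤g (suc i) zero    = z≤n
shiftXY-mono f≤g (suc i) (suc j) = f≤g i j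

∸-exchange : ∀ {w₁ w₂ s₁ s₂} → s₂ ≤ s₁ → w₂ + s₂ ≤ w₁ + s₁ →
             w₁ + (s₁ ∸ s₂) ≡ w₂ + ((w₁ + s₁) ∸ (w₂ + s₂))
∸-exchange {w₁} {w₂} {s₁} {s₂} s₂≤s₁ w₂+s₂≤w₁+s₁ = +-cancelʳ-≡ s₂ _ _ (begin
  w₁ + (s₁ ∸ s₂) + s₂  ≡⟨ +-assoc w₁ (s₁ ∸ s₂) s₂ ⟩
  w₁ + (s₁ ∸ s₂ + s₂)  ≡⟨ cong (w₁ +_) (m∸n+n≡m s₂≤s₁) ⟩
  w₁ + s₁              ≡⟨ sym (m+[n∸m]≡n w₂+s₂≤w₁+s₁) ⟩
  w₂ + s₂ + d          ≡⟨ +-assoc w₂ s₂ d ⟩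
  w₂ + (s₂ + d)        ≡⟨ cong (w₂ +_) (+-comm s₂ d) ⟩
  w₂ + (d + s₂)        ≡⟨ sym (+-assoc w₂ d s₂) ⟩
  w₂ + d + s₂          ∎)
  where
  open ≡-Reasoning
  d = (w₁ + s₁) ∸ (w₂ + s₂)

-- Pₖ = (1 - xy) Dₖ and D₂ ≤ D₁ give P₁ - P₂ = (1 - xy) (D₁ - D₂).
shiftXY-difference : ∀ {P₁ P₂ D₁ D₂ : ℕ → ℕ → ℕ} →
                     (∀ i j → D₁ i j ≡ P₁ i j + shiftXY D₁ i j) →
                     (∀ i j → D₂ i j ≡ P₂ i j + shiftXY D₂ i j) →
                     (∀ i j → D₂ i j ≤ D₁ i j) →
                     ∀ i j → P₁ i j + shiftXY (λ i j → D₁ i j ∸ D₂ i j) i j ≡ P₂ i j + (D₁ i j ∸ D₂ i j)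
shiftXY-difference {P₁} {P₂} {D₁} {D₂} D₁-rec D₂-rec D₂≤D₁ i j = begin
  P₁ i j + shiftXY (λ i j → D₁ i j ∸ D₂ i j) i j
    ≡⟨ cong (P₁ i j +_) (shiftXY-∸ i j) ⟩
  P₁ i j + (shiftXY D₁ i j ∸ shiftXY D₂ i j)
    ≡⟨ ∸-exchange (shiftXY-mono D₂≤D₁ i j) (subst₂ _≤_ (D₂-rec i j) (D₁-rec i j) (D₂≤D₁ i j)) ⟩
  P₂ i j + ((P₁ i j + shiftXY D₁ i j) ∸ (P₂ i j + shiftXY D₂ i j))
    ≡⟨ cong (P₂ i j +_) (sym (cong₂ _∸_ (D₁-rec i j) (D₂-rec i j))) ⟩
  P₂ i j + (D₁ i j ∸ D₂ i j) ∎
  where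
  open ≡-Reasoning
  shiftXY-∸ : ∀ i j → shiftXY (λ i j → D₁ i j ∸ D₂ i j) i j ≡ shiftXY D₁ i j ∸ shiftXY D₂ i j
  shiftXY-∸ zero    j       = refl
  shiftXY-∸ (suc i) zero    = refl
  shiftXY-∸ (suc i) (suc j) = refl

lemma4 : ∀ {n m} (G : Graph n m) → Connected G → Strong G → WhitneyMaximum G
lemma4 {n} {m} G G-connected G-strong H H-connected = Q , λ i j →
  trans (cong (W G i j +_) (shiftQ≡shiftXY Q i j))
        (shiftXY-difference (diagonalCount-recurrence G G-connected)
                            (diagonalCount-recurrence H H-connected)
                            (diagonalCount-mono G G-strong H H-connected) i j)
  where
  Q : NonnegPoly
  Q = record
    { coeff   = λ i j → diagonalCount G i j ∸ diagonalCount H i j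
    ; bound   = suc (n + m)
    ; support = λ i j → diagonalCount-support G H
    }
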